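{- Let $G$ be a unit disk graph. Consider Heuristic IS: starting from $G$ and an empty set $I$, repeat until the current graph is empty: choose a vertex $v$ of the current graph $H$ such that every independent set in the subgraph of $H$ induced on $N_H(v)$ has size at most 3, add $v$ to $I$, and delete $v$ and $N_H(v)$ from $H$. Let $IS(G)$ be the resulting set $I$ and let $OPT(G)$ be a maximum independent set of $G$. Then $|IS(G)| \ge |OPT(G)|/3$.
   Context: A graph is a unit disk graph if its vertices can be put in one-to-one correspondence with circles of radius 1 in the plane so that two vertices are adjacent if and only if the corresponding closed disks intersect (tangent circles intersect). Every induced subgraph of a unit disk graph is a unit disk graph, and every nonempty unit disk graph has a vertex $v$ with the stated property, so the heuristic is well defined. $N_H(v)$ is the set of neighbors of $v$ in $H$. -}

module Defs where

open import Level using (0ℓ)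
import Data.Nat
import Data.Product
open import Data.Nat using (ℕ)
open import Data.Fin using (Fin)
open import Data.Fin.Subset using (Subset; _∈_; _∉_; _⊆_; ∣_∣; Empty)
open import Data.Product using (Σ; _×_; _,_)
open import Data.List using (List; []; _∷_)
open import Relation.Binary.PropositionalEquality using (_≡_; _≢_)
open import Relation.Nullary using (¬_)
open import Relation.Binary.Structures using (IsTotalOrder)
open import Algebra.Bundles using (CommutativeRing)
open import Function.Bundles using (_⇔_)

record OrderedField : Set₁ where
  field
    commRing : CommutativeRing 0ℓ 0ℓ
  open CommutativeRing commRing public
  field
    _≤_          : Carrier → Carrier → Set
    isTotalOrder : IsTotalOrder _≈_ _≤_
    +-mono-≤     : ∀ {a b} c → a ≤ b → (a + c) ≤ (b + c)
    *-nonneg     : ∀ {a b} → 0# ≤ a → 0# ≤ b → 0# ≤ (a * b)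
    0≉1          : ¬ (0# ≈ 1#)
    inverse      : ∀ a → ¬ (a ≈ 0#) → Σ Carrier (λ b → (a * b) ≈ 1#)

record Graph (n : ℕ) : Set₁ where
  field
    Adj     : Fin n → Fin n → Set
    sym     : ∀ {u v} → Adj u v → Adj v u
    irrefl  : ∀ {u} → ¬ Adj u u

module _ {n : ℕ} (G : Graph n) where
  open Graph G

  -- G is a unit disk graph: vertices correspond one-to-one to unit circles
  -- (centres p v in the plane F²) and u ~ v iff the closed unit disks meet,
  -- i.e. the squared distance of the centres is at most 4.
  IsUnitDiskGraph : Set₁
  IsUnitDiskGraph =
    Σ OrderedField λ F → let open OrderedField F in
    Σ (Fin n → Carrier × Carrier) λ p →
      (∀ u v → (Data.Product.proj₁ (p u) ≈ Data.Product.proj₁ (p v))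
             → (Data.Product.proj₂ (p u) ≈ Data.Product.proj₂ (p v)) → u ≡ v)
    × (∀ u v → u ≢ v →
         Adj u v ⇔
           (let dx = Data.Product.proj₁ (p u) - Data.Product.proj₁ (p v)
                dy = Data.Product.proj₂ (p u) - Data.Product.proj₂ (p v)
            in ((dx * dx) + (dy * dy)) ≤ (1# + 1# + 1# + 1#)))

  Independent : Subset n → Set
  Independent S = ∀ u v → u ∈ S → v ∈ S → ¬ Adj u v

  NbhdIndepAtMost3 : Subset n → Fin n → Set
  NbhdIndepAtMost3 H v =
    ∀ S → S ⊆ H → (∀ u → u ∈ S → Adj v u) → Independent S → ∣ S ∣ Data.Nat.≤ 3

  -- HeuristicRun H I : a complete run of Heuristic IS started on the
  -- induced subgraph G[H] (and empty I) produces the chosen vertices I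
  -- (in order of choice).
  data HeuristicRun : Subset n → List (Fin n) → Set where
    done : ∀ {H} → Empty H → HeuristicRun H []
    step : ∀ {H H' I} (v : Fin n) → v ∈ H → NbhdIndepAtMost3 H v
         → (∀ u → (u ∈ H') ⇔ (u ∈ H × u ≢ v × ¬ Adj v u))
         → HeuristicRun H' I → HeuristicRun H (v ∷ I)

-- Each step of the heuristic removes at most three vertices of a fixed
-- independent set S: if the chosen vertex v lies in S, its neighbours are
-- not in S and only v itself is removed; otherwise every removed vertex of
-- S is a neighbour of v, so the removed part of S is an independent subset
-- of N_H(v), of size at most 3 by the choice of v. Summing over the steps
-- gives |S| ≤ 3 |I|. The unit disk hypothesis only guarantees that the
-- heuristic can always proceed.
module Submission where

open import Defs
open import Data.Nat using (ℕ; _*_; _≤_)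
open import Data.Fin using (Fin)
open import Data.Fin.Subset using (Subset; ⊤; ∣_∣)
open import Data.List using (List; length)

open import Data.Nat using (zero; suc; _+_; z≤n; s≤s; _≤?_)
open import Data.Nat.Properties using (≤-trans; ≤-reflexive; +-mono-≤; +-suc; +-comm; *-suc; ≤-refl; module ≤-Reasoning)
open import Data.Fin using (zero; suc; _≟_)
open import Data.Fin.Subset using (_∈_; _∉_; _⊆_; _∩_; _─_; ⁅_⁆; Empty; inside; outside)
open import Data.Fin.Subset.Properties
  using (_∈?_; p⊆q⇒∣p∣≤∣q∣; ∣p∩q∣≤∣q∣; Empty-unique; ∣⊥∣≡0; ∣⁅x⁆∣≡1; x∈⁅x⁆; x∈p∩q⁻; p─q⊆p; ∣p∩q∣≤∣p∣; ∩-assoc; ∩-comm; ∩-identityʳ)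
open import Data.Vec using ([]; _∷_; here; there)
open import Data.List using () renaming (_∷_ to _∷ₗ_)
open import Data.Product using (_,_; _×_; proj₁; proj₂)
open import Data.Empty using (⊥-elim)
open import Relation.Nullary using (¬_; yes; no; contradiction)
open import Relation.Nullary.Decidable using (decidable-stable)
open import Relation.Binary.PropositionalEquality using (_≡_; _≢_; refl; cong; sym; trans; subst; module ≡-Reasoning)
open import Function.Bundles using (_⇔_; Equivalence)

x∈p─q⁻ : ∀ {n} {x : Fin n} (p q : Subset n) → x ∈ p ─ q → x ∈ p × x ∉ q
x∈p─q⁻ p q x∈p─q = p─q⊆p p q x∈p─q , x∉q p q x∈p─q
  where
  x∉q : ∀ {n} {x : Fin n} (p q : Subset n) → x ∈ p ─ q → x ∉ q
  x∉q (_ ∷ p) (outside ∷ q) here        ()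
  x∉q (_ ∷ p) (_       ∷ q) (there x∈) (there x∈q) = x∉q p q x∈ x∈q

∣p∣≡∣p∩q∣+∣p─q∣ : ∀ {n} (p q : Subset n) → ∣ p ∣ ≡ ∣ p ∩ q ∣ + ∣ p ─ q ∣
∣p∣≡∣p∩q∣+∣p─q∣ []            []            = refl
∣p∣≡∣p∩q∣+∣p─q∣ (inside  ∷ p) (inside  ∷ q) = cong suc (∣p∣≡∣p∩q∣+∣p─q∣ p q)
∣p∣≡∣p∩q∣+∣p─q∣ (inside  ∷ p) (outside ∷ q) =
  trans (cong suc (∣p∣≡∣p∩q∣+∣p─q∣ p q)) (sym (+-suc ∣ p ∩ q ∣ ∣ p ─ q ∣))
∣p∣≡∣p∩q∣+∣p─q∣ (outside ∷ p) (inside  ∷ q) = ∣p∣≡∣p∩q∣+∣p─q∣ p q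
∣p∣≡∣p∩q∣+∣p─q∣ (outside ∷ p) (outside ∷ q) = ∣p∣≡∣p∩q∣+∣p─q∣ p q

∣p∩q∩r∣≤∣p∩r∣ : ∀ {n} (p q r : Subset n) → ∣ (p ∩ q) ∩ r ∣ ≤ ∣ p ∩ r ∣
∣p∩q∩r∣≤∣p∩r∣ p q r = ≤-trans (≤-reflexive (cong ∣_∣ reorder)) (∣p∩q∣≤∣p∣ (p ∩ r) q)
  where
  open ≡-Reasoning
  reorder : (p ∩ q) ∩ r ≡ (p ∩ r) ∩ q
  reorder = begin
    (p ∩ q) ∩ r  ≡⟨ ∩-assoc p q r ⟩
    p ∩ (q ∩ r)  ≡⟨ cong (p ∩_) (∩-comm q r) ⟩
    p ∩ (r ∩ q)  ≡⟨ sym (∩-assoc p r q) ⟩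
    (p ∩ r) ∩ q  ∎

∣Empty∣≡0 : ∀ {n} {p : Subset n} → Empty p → ∣ p ∣ ≡ 0
∣Empty∣≡0 {n} e rewrite Empty-unique e = ∣⊥∣≡0 n

¬¬-∀-Fin : ∀ {n} {P : Fin n → Set} → (∀ i → ¬ ¬ P i) → ¬ ¬ (∀ i → P i)
¬¬-∀-Fin {zero}  ¬¬P ¬∀P = ¬∀P (λ ())
¬¬-∀-Fin {suc n} ¬¬P ¬∀P =
  ¬¬P zero λ P0 → ¬¬-∀-Fin (λ i → ¬¬P (suc i)) λ Psuc →
    ¬∀P λ { zero → P0 ; (suc i) → Psuc i }

¬¬-∀-∈ : ∀ {n} {p : Subset n} {P : Fin n → Set} →
         (∀ i → i ∈ p → ¬ ¬ P i) → ¬ ¬ (∀ i → i ∈ p → P i)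
¬¬-∀-∈ {p = p} {P} ¬¬P = ¬¬-∀-Fin ¬¬P⇐∈
  where
  ¬¬P⇐∈ : ∀ i → ¬ ¬ (i ∈ p → P i)
  ¬¬P⇐∈ i with i ∈? p
  ... | yes i∈p = λ ¬P⇐∈ → ¬¬P i i∈p (λ Pi → ¬P⇐∈ (λ _ → Pi))
  ... | no  i∉p = λ ¬P⇐∈ → ¬P⇐∈ (λ i∈p → contradiction i∈p i∉p)

module _ {n : ℕ} (G : Graph n) where
  open Graph G using (Adj)

  DeletesClosedNbhd : Subset n → Fin n → Subset n → Set
  DeletesClosedNbhd H v H′ = ∀ u → (u ∈ H′) ⇔ (u ∈ H × u ≢ v × ¬ Adj v u)

  deleted-⇒-¬¬Adj : ∀ {H v H′ x} → DeletesClosedNbhd H v H′ →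
                    x ∈ H → x ∉ H′ → x ≢ v → ¬ ¬ Adj v x
  deleted-⇒-¬¬Adj del x∈H x∉H′ x≢v ¬adj =
    x∉H′ (Equivalence.from (del _) (x∈H , x≢v , ¬adj))

  step-deletes-≤3 : ∀ {H v H′} → NbhdIndepAtMost3 G H v → DeletesClosedNbhd H v H′ →
                    ∀ S → Independent G S → ∣ (S ∩ H) ─ H′ ∣ ≤ 3
  step-deletes-≤3 {H} {v} {H′} nbhd del S indep with v ∈? S
  ... | yes v∈S = ≤-trans (p⊆q⇒∣p∣≤∣q∣ D⊆⁅v⁆) (≤-trans (≤-reflexive (∣⁅x⁆∣≡1 v)) (s≤s z≤n))
    where
    D⊆⁅v⁆ : (S ∩ H) ─ H′ ⊆ ⁅ v ⁆
    D⊆⁅v⁆ {x} x∈D with x ≟ v | x∈p─q⁻ (S ∩ H) H′ x∈D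
    ... | yes refl | _ = x∈⁅x⁆ v
    ... | no  x≢v  | x∈S∩H , x∉H′ with x∈p∩q⁻ S H x∈S∩H
    ...   | x∈S , x∈H = ⊥-elim (deleted-⇒-¬¬Adj del x∈H x∉H′ x≢v (indep v x v∈S x∈S))
  -- Adjacency need not be decidable, so the removed vertices are only known
  -- to be ¬¬-adjacent to v; the bound is decidable and hence ¬¬-stable.
  ... | no  v∉S = decidable-stable (∣ D ∣ ≤? 3) λ ∣D∣≰3 →
    ¬¬-∀-∈ D⇒¬¬Adj λ D⇒Adj → ∣D∣≰3 (nbhd D D⊆H D⇒Adj D-independent)
    where
    D : Subset n
    D = (S ∩ H) ─ H′
    D⊆S∩H : D ⊆ S ∩ H
    D⊆S∩H = p─q⊆p (S ∩ H) H′
    D⊆H : D ⊆ H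
    D⊆H x∈D = proj₂ (x∈p∩q⁻ S H (D⊆S∩H x∈D))
    D-independent : Independent G D
    D-independent u w u∈D w∈D =
      indep u w (proj₁ (x∈p∩q⁻ S H (D⊆S∩H u∈D))) (proj₁ (x∈p∩q⁻ S H (D⊆S∩H w∈D)))
    D⇒¬¬Adj : ∀ x → x ∈ D → ¬ ¬ Adj v x
    D⇒¬¬Adj x x∈D = deleted-⇒-¬¬Adj del (D⊆H x∈D) (proj₂ (x∈p─q⁻ (S ∩ H) H′ x∈D))
      λ { refl → v∉S (proj₁ (x∈p∩q⁻ S H (D⊆S∩H x∈D))) }

  run-bound : ∀ {H I} → HeuristicRun G H I → ∀ S → Independent G S →
              ∣ S ∩ H ∣ ≤ 3 * length I
  run-bound {H} (done empty) S indep =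
    ≤-trans (∣p∩q∣≤∣q∣ S H) (≤-reflexive (∣Empty∣≡0 empty))
  run-bound {H} (step {H' = H′} {I = I} v _ nbhd del run) S indep = begin
    ∣ S ∩ H ∣                            ≡⟨ ∣p∣≡∣p∩q∣+∣p─q∣ (S ∩ H) H′ ⟩
    ∣ (S ∩ H) ∩ H′ ∣ + ∣ (S ∩ H) ─ H′ ∣  ≤⟨ +-mono-≤ (∣p∩q∩r∣≤∣p∩r∣ S H H′) (step-deletes-≤3 nbhd del S indep) ⟩
    ∣ S ∩ H′ ∣ + 3                       ≤⟨ +-mono-≤ (run-bound run S indep) ≤-refl ⟩
    3 * length I + 3                     ≡⟨ +-comm (3 * length I) 3 ⟩
    3 + 3 * length I                     ≡⟨ *-suc 3 (length I) ⟨
    3 * length (v ∷ₗ I)                  ∎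
    where open ≤-Reasoning

theorem4p7 : ∀ {n : ℕ} (G : Graph n) → IsUnitDiskGraph G
    → (I : List (Fin n)) → HeuristicRun G ⊤ I
    → (S : Subset n) → Independent G S → ∣ S ∣ ≤ 3 * length I
theorem4p7 G _ I run S indep =
  subst (_≤ 3 * length I) (cong ∣_∣ (∩-identityʳ S)) (run-bound G run S indep)
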